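{- Let $K_n$ be the complete graph on $n$ vertices and $k$ a positive integer. Then $$\lambda_v^k(K_n)=\begin{cases}0 & \text{if } k\ge n,\\ n-k-(k\bmod 2) & \text{if } k<n.\end{cases}$$
   Context: Let $\lambda(G)$ denote the chromatic index of a simple graph $G$. For a positive integer $k$ and a graph $G=(V,E)$, a set $V'\subseteq V$ is a $k$-chromatic index vertex removal set if $\lambda(G-V')\le k$, where $G-V'$ is obtained by deleting the vertices of $V'$ and their incident edges. The parameter $\lambda_v^k(G)$ is the minimum of $|V'|$ over all $k$-chromatic index vertex removal sets $V'$. -}

module Defs where

open import Data.Nat using (ℕ; _≤_)
open import Data.Fin using (Fin)
open import Data.Fin.Subset using (Subset; _∉_; ∣_∣)
open import Data.Product using (Σ; _×_; _,_; proj₁; ∃-syntax)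
open import Relation.Nullary using (¬_)
open import Relation.Binary.PropositionalEquality using (_≡_; _≢_; refl) renaming (sym to ≡-sym)

record SimpleGraph (V : Set) : Set₁ where
  field
    Adj    : V → V → Set
    sym    : ∀ {u v} → Adj u v → Adj v u
    irrefl : ∀ {v} → ¬ Adj v v
open SimpleGraph public

K : (n : ℕ) → SimpleGraph (Fin n)
K n = record { Adj = λ u v → u ≢ v ; sym = λ p q → p (≡-sym q) ; irrefl = λ p → p refl }

_─_ : ∀ {n} → SimpleGraph (Fin n) → (S : Subset n) → SimpleGraph (Σ (Fin n) (λ v → v ∉ S))
G ─ S = record
  { Adj    = λ u v → Adj G (proj₁ u) (proj₁ v)
  ; sym    = SimpleGraph.sym G
  ; irrefl = SimpleGraph.irrefl G }

record EdgeColoring {V : Set} (G : SimpleGraph V) (k : ℕ) : Set where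
  field
    colour    : ∀ u v → Adj G u v → Fin k
    symmetric : ∀ u v (p : Adj G u v) (q : Adj G v u) → colour u v p ≡ colour v u q
    proper    : ∀ u v w (p : Adj G u v) (q : Adj G u w) → v ≢ w → colour u v p ≢ colour u w q

ChromaticIndex≤ : {V : Set} → SimpleGraph V → ℕ → Set
ChromaticIndex≤ G k = EdgeColoring G k

IsRemovalSet : ∀ {n} → SimpleGraph (Fin n) → ℕ → Subset n → Set
IsRemovalSet G k S = ChromaticIndex≤ (G ─ S) k

λv≡ : ∀ {n} → SimpleGraph (Fin n) → ℕ → ℕ → Set
λv≡ G k m = (∃[ S ] (IsRemovalSet G k S × ∣ S ∣ ≡ m))
          × (∀ S → IsRemovalSet G k S → m ≤ ∣ S ∣)

-- Deleting vertices of K_n leaves a complete graph on the remaining vertices, so the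
-- question is for which m the graph K_m is k-edge-colourable; the answer is
-- m ≤ k + (k mod 2). Colouring the edge uv by u + v mod k colours K_k; for odd k the
-- diagonal colours 2u mod k are pairwise distinct and colour the edges to an extra
-- vertex, giving K_{k+1}. Conversely K_{k+2} has a vertex of degree k + 1, and in a
-- k-colouring of K_{k+1} every vertex meets every colour, so a colour class is a
-- perfect matching and k + 1 is even.
module Submission where

open import Defs hiding (sym)
open import Data.Nat
  using (ℕ; suc; _+_; _*_; _∸_; _≤_; _<_; _≥_; z≤n; s≤s; NonZero; >-nonZero; >-nonZero⁻¹)
open import Data.Nat.Properties
  using (+-assoc; +-comm; +-identityʳ; *-assoc; *-identityˡ; <⇒≤; ≮⇒≥; 1+n≰n; ≤-reflexive;
         ≤-trans; +-monoˡ-≤; m∸n≤m; m∸n+n≡m; m≤n+m∸n; m≤n+o⇒m∸n≤o; m≤n⇒m≤n+o; m≤n⇒m∸n≡0;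
         ∸-+-assoc; module ≤-Reasoning)
open import Data.Nat.DivMod
  using (_%_; _/_; _mod_; %-distribˡ-+; %-distribˡ-*; [m+n]%n≡m%n; m≡m%n+[m/n]*n; m%n<n;
         m<n⇒m%n≡m)
open import Data.Nat.Divisibility using (_∣_; _∣0; ∣-refl; ∣m∣n⇒∣m+n; ∣m+n∣m⇒∣n; ∣1⇒≡1; m%n≡0⇒n∣m)
open import Data.Fin using (Fin; zero; suc; toℕ; fromℕ<; inject≤; punchIn; punchOut)
open import Data.Fin.Properties
  using (_≟_; any?; toℕ<n; toℕ-injective; fromℕ<-injective; inject≤-injective;
         punchIn-injective; punchInᵢ≢i; punchOut-injective; suc-injective; injective⇒≤)
open import Data.Fin.Subset
  using (Subset; inside; outside; _∈_; _∉_; _⊂_; _-_; ∁; ∣_∣; ⊤) renaming (⊥ to ∅)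
open import Data.Fin.Subset.Properties
  using (_∈?_; Empty-unique; ∈⊤; ∣⊤∣≡n; ∣⊥∣≡0; ∣∁p∣≡n∸∣p∣; ∣p∣≤n; p─⊥≡p; p─q⊆p; ⊆-⊂-trans;
         x∈p⇒p-x⊂p; x∈p∧x≢y⇒x∈p-y; x∈∁p⇒x∉p; x∉p⇒x∈∁p)
open import Data.Fin.Subset.Induction using (Acc; acc; ⊂-wellFounded)
open import Data.Vec using (_∷_; here; there)
open import Data.Product using (Σ; _×_; _,_; proj₁; proj₂; ∃-syntax)
open import Function using (_∘_; id)
open import Function.Bundles using (_⇔_; mk⇔; Equivalence)
open import Function.Definitions using (Injective)
open import Relation.Nullary using (¬_; yes; no; contradiction)
open import Relation.Nullary.Decidable using (decidable-stable)
open import Relation.Binary.PropositionalEquality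
  using (_≡_; _≢_; refl; sym; trans; cong; subst; subst₂; module ≡-Reasoning)

open EdgeColoring

module _ {d : ℕ} .{{_ : NonZero d}} where

  open ≡-Reasoning

  %-+-congˡ : ∀ m {x y} → x % d ≡ y % d → (m + x) % d ≡ (m + y) % d
  %-+-congˡ m {x} {y} eq = begin
    (m + x) % d          ≡⟨ %-distribˡ-+ m x d ⟩
    (m % d + x % d) % d  ≡⟨ cong (λ r → (m % d + r) % d) eq ⟩
    (m % d + y % d) % d  ≡⟨ sym (%-distribˡ-+ m y d) ⟩
    (m + y) % d          ∎

  %-*-congˡ : ∀ m {x y} → x % d ≡ y % d → (m * x) % d ≡ (m * y) % d
  %-*-congˡ m {x} {y} eq = begin
    (m * x) % d            ≡⟨ %-distribˡ-* m x d ⟩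
    (m % d * (x % d)) % d  ≡⟨ cong (λ r → (m % d * r) % d) eq ⟩
    (m % d * (y % d)) % d  ≡⟨ sym (%-distribˡ-* m y d) ⟩
    (m * y) % d            ∎

  -- Adding d ∸ a undoes adding a.
  +-cancelˡ-% : ∀ {a b c} → a ≤ d → (a + b) % d ≡ (a + c) % d → b % d ≡ c % d
  +-cancelˡ-% {a} {b} {c} a≤d eq = begin
    b % d                  ≡⟨ sym (unshift b) ⟩
    (d ∸ a + (a + b)) % d  ≡⟨ %-+-congˡ (d ∸ a) eq ⟩
    (d ∸ a + (a + c)) % d  ≡⟨ unshift c ⟩
    c % d                  ∎
    where
    unshift : ∀ x → (d ∸ a + (a + x)) % d ≡ x % d
    unshift x = begin
      (d ∸ a + (a + x)) % d  ≡⟨ cong (_% d) (sym (+-assoc (d ∸ a) a x)) ⟩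
      (d ∸ a + a + x) % d    ≡⟨ cong (λ t → (t + x) % d) (m∸n+n≡m a≤d) ⟩
      (d + x) % d            ≡⟨ cong (_% d) (+-comm d x) ⟩
      (x + d) % d            ≡⟨ [m+n]%n≡m%n x d ⟩
      x % d                  ∎

  *-cancelˡ-% : ∀ {m m′ a b} → (m′ * m) % d ≡ 1 % d → (m * a) % d ≡ (m * b) % d → a % d ≡ b % d
  *-cancelˡ-% {m} {m′} {a} {b} inverse eq = begin
    a % d               ≡⟨ sym (undo a) ⟩
    (m′ * (m * a)) % d  ≡⟨ %-*-congˡ m′ eq ⟩
    (m′ * (m * b)) % d  ≡⟨ undo b ⟩
    b % d               ∎
    where
    undo : ∀ x → (m′ * (m * x)) % d ≡ x % d
    undo x = begin
      (m′ * (m * x)) % d              ≡⟨ cong (_% d) (sym (*-assoc m′ m x)) ⟩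
      (m′ * m * x) % d                ≡⟨ %-distribˡ-* (m′ * m) x d ⟩
      ((m′ * m) % d * (x % d)) % d    ≡⟨ cong (λ r → (r * (x % d)) % d) inverse ⟩
      (1 % d * (x % d)) % d           ≡⟨ sym (%-distribˡ-* 1 x d) ⟩
      (1 * x) % d                     ≡⟨ cong (_% d) (*-identityˡ x) ⟩
      x % d                           ∎

  toℕ-%-injective : ∀ {u v : Fin d} → toℕ u % d ≡ toℕ v % d → u ≡ v
  toℕ-%-injective {u} {v} eq =
    toℕ-injective (trans (sym (m<n⇒m%n≡m (toℕ<n u))) (trans eq (m<n⇒m%n≡m (toℕ<n v))))

  mod≡⇒%≡ : ∀ {x y} → x mod d ≡ y mod d → x % d ≡ y % d
  mod≡⇒%≡ = fromℕ<-injective _ _ _ _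

half-inverse : ∀ k .{{_ : NonZero k}} → k % 2 ≡ 1 → (suc (k / 2) * 2) % k ≡ 1 % k
half-inverse k k%2≡1 = trans (cong (_% k) (cong suc (sym odd))) ([m+n]%n≡m%n 1 k)
  where
  odd : k ≡ 1 + k / 2 * 2
  odd = trans (m≡m%n+[m/n]*n k 2) (cong (_+ k / 2 * 2) k%2≡1)

injective⇒surjective : ∀ {n} {f : Fin n → Fin n} → Injective _≡_ _≡_ f → ∀ y → ∃[ x ] f x ≡ y
injective⇒surjective {suc n} {f} f-injective y with any? (λ x → f x ≟ y)
... | yes hit  = hit
... | no  miss = contradiction (injective⇒≤ g-injective) 1+n≰n
  where
  y≢f : ∀ x → y ≢ f x
  y≢f x y≡fx = miss (x , sym y≡fx)
  g : Fin (suc n) → Fin n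
  g x = punchOut (y≢f x)
  g-injective : Injective _≡_ _≡_ g
  g-injective = f-injective ∘ punchOut-injective (y≢f _) (y≢f _)

x∈p⇒suc∣p-x∣≡∣p∣ : ∀ {n} {p : Subset n} {x} → x ∈ p → suc ∣ p - x ∣ ≡ ∣ p ∣
x∈p⇒suc∣p-x∣≡∣p∣ {p = inside  ∷ p} {zero}  here        = cong (suc ∘ ∣_∣) (p─⊥≡p p)
x∈p⇒suc∣p-x∣≡∣p∣ {p = inside  ∷ p} {suc x} (there x∈p) = cong suc (x∈p⇒suc∣p-x∣≡∣p∣ x∈p)
x∈p⇒suc∣p-x∣≡∣p∣ {p = outside ∷ p} {suc x} (there x∈p) = x∈p⇒suc∣p-x∣≡∣p∣ x∈p

x∈p-y⇒x≢y : ∀ {n} {p : Subset n} {x y} → x ∈ p - y → x ≢ y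
x∈p-y⇒x≢y {p = _ ∷ _} {zero}  {zero}  ()
x∈p-y⇒x≢y {p = _ ∷ _} {zero}  {suc y} _ ()
x∈p-y⇒x≢y {p = _ ∷ _} {suc x} {zero}  _ ()
x∈p-y⇒x≢y {p = _ ∷ _} {suc x} {suc y} (there x∈p-y) = x∈p-y⇒x≢y x∈p-y ∘ suc-injective

module _ {N : ℕ} (p : Fin N → Fin N) (p-≢ : ∀ x → p x ≢ x) (p-involutive : ∀ x → p (p x) ≡ x) where

  private
    Closed : Subset N → Set
    Closed X = ∀ {x} → x ∈ X → p x ∈ X

    -- Removing an orbit {x, p x} keeps the set closed and lowers its size by 2.
    closed⇒even : ∀ X → Acc _⊂_ X → Closed X → 2 ∣ ∣ X ∣
    closed⇒even X (acc smaller) closed with any? (_∈? X)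
    ... | no empty = subst (2 ∣_) (sym (trans (cong ∣_∣ (Empty-unique empty)) (∣⊥∣≡0 N))) (2 ∣0)
    ... | yes (x , x∈X) = subst (2 ∣_) size (∣m∣n⇒∣m+n ∣-refl (closed⇒even Y (smaller Y⊂X) Y-closed))
      where
      px∈X-x : p x ∈ X - x
      px∈X-x = x∈p∧x≢y⇒x∈p-y (closed x∈X) (p-≢ x)
      Y : Subset N
      Y = X - x - p x
      Y⊂X : Y ⊂ X
      Y⊂X = ⊆-⊂-trans (p─q⊆p (X - x) _) (x∈p⇒p-x⊂p x∈X)
      size : 2 + ∣ Y ∣ ≡ ∣ X ∣
      size = trans (cong suc (x∈p⇒suc∣p-x∣≡∣p∣ px∈X-x)) (x∈p⇒suc∣p-x∣≡∣p∣ x∈X)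
      Y-closed : Closed Y
      Y-closed {y} y∈Y = x∈p∧x≢y⇒x∈p-y (x∈p∧x≢y⇒x∈p-y (closed y∈X) py≢x) py≢px
        where
        y∈X-x : y ∈ X - x
        y∈X-x = p─q⊆p (X - x) _ y∈Y
        y∈X : y ∈ X
        y∈X = p─q⊆p X _ y∈X-x
        py≢x : p y ≢ x
        py≢x py≡x = x∈p-y⇒x≢y y∈Y (trans (sym (p-involutive y)) (cong p py≡x))
        py≢px : p y ≢ p x
        py≢px py≡px = x∈p-y⇒x≢y y∈X-x
          (trans (sym (p-involutive y)) (trans (cong p py≡px) (p-involutive x)))

  involution⇒even : 2 ∣ N
  involution⇒even = subst (2 ∣_) (∣⊤∣≡n N) (closed⇒even ⊤ (⊂-wellFounded ⊤) (λ _ → ∈⊤))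

IsComplete : {V : Set} → SimpleGraph V → Set
IsComplete H = ∀ {u v} → u ≢ v → Adj H u v

pullback : ∀ {V W : Set} {G : SimpleGraph V} {H : SimpleGraph W} {k} → IsComplete H →
           (f : V → W) → Injective _≡_ _≡_ f → EdgeColoring H k → EdgeColoring G k
pullback {G = G} {H} H-complete f f-injective C = record
  { colour    = λ u v p → colour C (f u) (f v) (adj p)
  ; symmetric = λ u v p q → symmetric C (f u) (f v) (adj p) (adj q)
  ; proper    = λ u v w p q v≢w → proper C (f u) (f v) (f w) (adj p) (adj q) (v≢w ∘ f-injective)
  }
  where
  adj : ∀ {u v} → Adj G u v → Adj H (f u) (f v)
  adj {u} p = H-complete (λ fu≡fv → irrefl G (subst (Adj G u) (sym (f-injective fu≡fv)) p))

K-complete : ∀ n → IsComplete (K n)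
K-complete n = id

-- Proofs of x ∉ S are functions into an irrelevant ⊥, hence definitionally equal.
vertex-≡ : ∀ {n} {S : Subset n} {u v : Σ (Fin n) (_∉ S)} → proj₁ u ≡ proj₁ v → u ≡ v
vertex-≡ refl = refl

K─-complete : ∀ {n} (S : Subset n) → IsComplete (K n ─ S)
K─-complete S u≢v = u≢v ∘ vertex-≡

K-restrict : ∀ {m m′ k} → m ≤ m′ → EdgeColoring (K m′) k → EdgeColoring (K m) k
K-restrict {m′ = m′} m≤m′ =
  pullback (K-complete m′) (λ i → inject≤ i m≤m′) (inject≤-injective m≤m′ m≤m′ _ _)

colour-injective : ∀ {n k} {G : SimpleGraph (Fin n)} (C : EdgeColoring G k) u {v w} p q →
                   colour C u v p ≡ colour C u w q → v ≡ w
colour-injective C u {v} {w} p q same =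
  decidable-stable (v ≟ w) (λ v≢w → proper C u v w p q v≢w same)

module _ {m k} (L : Fin m → Fin m → Fin k) (L-comm : ∀ u v → L u v ≡ L v u)
         (L-cancelˡ : ∀ u → Injective _≡_ _≡_ (L u)) where

  latinColouring : EdgeColoring (K m) k
  latinColouring = record
    { colour    = λ u v _ → L u v
    ; symmetric = λ u v _ _ → L-comm u v
    ; proper    = λ u v w _ _ v≢w → v≢w ∘ L-cancelˡ u
    }

  -- The diagonal entry L u u is the one colour missing at u; when these are pairwise
  -- distinct they colour the edges to a new vertex.
  diagonalExtension : (∀ {u v} → L u u ≡ L v v → u ≡ v) → EdgeColoring (K (suc m)) k
  diagonalExtension diagonal-injective = record
    { colour = extended ; symmetric = extended-symmetric ; proper = extended-proper }
    where
    extended : ∀ u v → u ≢ v → Fin k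
    extended zero    zero    0≢0 = contradiction refl 0≢0
    extended zero    (suc v) _   = L v v
    extended (suc u) zero    _   = L u u
    extended (suc u) (suc v) _   = L u v

    extended-symmetric : ∀ u v p q → extended u v p ≡ extended v u q
    extended-symmetric zero    zero    0≢0 _ = contradiction refl 0≢0
    extended-symmetric zero    (suc v) _   _ = refl
    extended-symmetric (suc u) zero    _   _ = refl
    extended-symmetric (suc u) (suc v) _   _ = L-comm u v

    extended-proper : ∀ u v w p q → v ≢ w → extended u v p ≢ extended u w q
    extended-proper zero    zero    _       0≢0 _   _   = contradiction refl 0≢0
    extended-proper zero    (suc v) zero    _   0≢0 _   = contradiction refl 0≢0
    extended-proper zero    (suc v) (suc w) _   _   v≢w = v≢w ∘ cong suc ∘ diagonal-injective
    extended-proper (suc u) zero    zero    _   _   v≢w = contradiction refl v≢w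
    extended-proper (suc u) zero    (suc w) _   u≢w _   = u≢w ∘ cong suc ∘ L-cancelˡ u
    extended-proper (suc u) (suc v) zero    u≢v _   _   = u≢v ∘ sym ∘ cong suc ∘ L-cancelˡ u
    extended-proper (suc u) (suc v) (suc w) _   _   v≢w = v≢w ∘ cong suc ∘ L-cancelˡ u

module Cyclic (k : ℕ) .{{_ : NonZero k}} where

  _⊕_ : Fin k → Fin k → Fin k
  u ⊕ v = (toℕ u + toℕ v) mod k

  ⊕-comm : ∀ u v → u ⊕ v ≡ v ⊕ u
  ⊕-comm u v = cong (_mod k) (+-comm (toℕ u) (toℕ v))

  ⊕-cancelˡ : ∀ u → Injective _≡_ _≡_ (u ⊕_)
  ⊕-cancelˡ u = toℕ-%-injective ∘ +-cancelˡ-% (<⇒≤ (toℕ<n u)) ∘ mod≡⇒%≡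

  ⊕-diagonal-injective : k % 2 ≡ 1 → ∀ {u v} → u ⊕ u ≡ v ⊕ v → u ≡ v
  ⊕-diagonal-injective k%2≡1 {u} {v} =
    toℕ-%-injective ∘ *-cancelˡ-% {m = 2} {m′ = suc (k / 2)} (half-inverse k k%2≡1)
                    ∘ doubled ∘ mod≡⇒%≡
    where
    double : ∀ w → toℕ w + toℕ w ≡ 2 * toℕ w
    double w = cong (toℕ w +_) (sym (+-identityʳ (toℕ w)))
    doubled : (toℕ u + toℕ u) % k ≡ (toℕ v + toℕ v) % k → (2 * toℕ u) % k ≡ (2 * toℕ v) % k
    doubled = subst₂ (λ x y → x % k ≡ y % k) (double u) (double v)

  cyclicColouring : EdgeColoring (K k) k
  cyclicColouring = latinColouring _⊕_ ⊕-comm ⊕-cancelˡ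

  oddColouring : k % 2 ≡ 1 → EdgeColoring (K (suc k)) k
  oddColouring k%2≡1 = diagonalExtension _⊕_ ⊕-comm ⊕-cancelˡ (⊕-diagonal-injective k%2≡1)

K[2+k]-uncolourable : ∀ k → ¬ EdgeColoring (K (suc (suc k))) k
K[2+k]-uncolourable k C = 1+n≰n (injective⇒≤ star-injective)
  where
  star : Fin (suc k) → Fin k
  star i = colour C zero (suc i) (λ ())
  star-injective : Injective _≡_ _≡_ star
  star-injective = suc-injective ∘ colour-injective C zero _ _

module ColourClass {k} (C : EdgeColoring (K (suc k)) k) (c : Fin k) where

  ≢punchIn : ∀ u (i : Fin k) → u ≢ punchIn u i
  ≢punchIn u i = punchInᵢ≢i u i ∘ sym

  -- Each vertex has k neighbours with pairwise distinct colours, so it meets every colour.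
  meets-c : ∀ u → ∃[ i ] colour C u (punchIn u i) (≢punchIn u i) ≡ c
  meets-c u = injective⇒surjective (punchIn-injective u _ _ ∘ colour-injective C u _ _) c

  mate : Fin (suc k) → Fin (suc k)
  mate u = punchIn u (proj₁ (meets-c u))

  ≢mate : ∀ u → u ≢ mate u
  ≢mate u = ≢punchIn u _

  mate-involutive : ∀ u → mate (mate u) ≡ u
  mate-involutive u with mate (mate u) ≟ u
  ... | yes returns = returns
  ... | no  elsewhere = contradiction (trans c-at-mate (sym c-at-u))
                          (proper C w (mate w) u (≢mate w) w≢u elsewhere)
    where
    w : Fin (suc k)
    w = mate u
    w≢u : w ≢ u
    w≢u = ≢mate u ∘ sym
    c-at-mate : colour C w (mate w) (≢mate w) ≡ c
    c-at-mate = proj₂ (meets-c w)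
    c-at-u : colour C w u w≢u ≡ c
    c-at-u = trans (symmetric C w u w≢u (≢mate u)) (proj₂ (meets-c u))

K[1+k]-colourable⇒even : ∀ {k} → EdgeColoring (K (suc k)) k → Fin k → 2 ∣ suc k
K[1+k]-colourable⇒even C c = involution⇒even mate (λ u → ≢mate u ∘ sym) mate-involutive
  where open ColourClass C c

K[1+k]-uncolourable : ∀ k → 2 ∣ k → Fin k → ¬ EdgeColoring (K (suc k)) k
K[1+k]-uncolourable k 2∣k c C = contradiction (∣1⇒≡1 (∣m+n∣m⇒∣n 2∣k+1 2∣k)) λ ()
  where
  2∣k+1 : 2 ∣ k + 1
  2∣k+1 = subst (2 ∣_) (+-comm 1 k) (K[1+k]-colourable⇒even C c)

K-colourable⇔ : ∀ {m} k .{{_ : NonZero k}} → EdgeColoring (K m) k ⇔ m ≤ k + k % 2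
K-colourable⇔ {m} k with k % 2 in k%2≡r | m%n<n k 2
... | 0 | _ rewrite +-identityʳ k = mk⇔
  (λ C → ≮⇒≥ (λ k<m → K[1+k]-uncolourable k (m%n≡0⇒n∣m k 2 k%2≡r) colour₀ (K-restrict k<m C)))
  (λ m≤k → K-restrict m≤k cyclicColouring)
  where
  open Cyclic k
  colour₀ : Fin k
  colour₀ = fromℕ< (>-nonZero⁻¹ k)
... | 1 | _ rewrite +-comm k 1 = mk⇔
  (λ C → ≮⇒≥ (λ 1+k<m → K[2+k]-uncolourable k (K-restrict 1+k<m C)))
  (λ m≤1+k → K-restrict m≤1+k (oddColouring k%2≡r))
  where open Cyclic k
... | suc (suc _) | s≤s (s≤s ())

members : ∀ {n} (X : Subset n) → Fin ∣ X ∣ → Fin n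
members (inside  ∷ X) zero    = zero
members (inside  ∷ X) (suc i) = suc (members X i)
members (outside ∷ X) i       = suc (members X i)

members-∈ : ∀ {n} (X : Subset n) i → members X i ∈ X
members-∈ (inside  ∷ X) zero    = here
members-∈ (inside  ∷ X) (suc i) = there (members-∈ X i)
members-∈ (outside ∷ X) i       = there (members-∈ X i)

members-injective : ∀ {n} (X : Subset n) → Injective _≡_ _≡_ (members X)
members-injective (inside  ∷ X) {zero}  {zero}  _ = refl
members-injective (inside  ∷ X) {suc i} {suc j} e = cong suc (members-injective X (suc-injective e))
members-injective (outside ∷ X) e = members-injective X (suc-injective e)

rank : ∀ {n} {X : Subset n} {x} → x ∈ X → Fin ∣ X ∣
rank here = zero
rank {X = inside  ∷ _} (there x∈X) = suc (rank x∈X)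
rank {X = outside ∷ _} (there x∈X) = rank x∈X

members-rank : ∀ {n} {X : Subset n} {x} (x∈X : x ∈ X) → members X (rank x∈X) ≡ x
members-rank here = refl
members-rank {X = inside  ∷ _} (there x∈X) = cong suc (members-rank x∈X)
members-rank {X = outside ∷ _} (there x∈X) = cong suc (members-rank x∈X)

removal⇔K∁ : ∀ {n k} (S : Subset n) → IsRemovalSet (K n) k S ⇔ EdgeColoring (K ∣ ∁ S ∣) k
removal⇔K∁ S = mk⇔
  (pullback (K─-complete S) (λ i → members (∁ S) i , x∈∁p⇒x∉p (members-∈ (∁ S) i))
    (members-injective (∁ S) ∘ cong proj₁))
  (pullback (K-complete ∣ ∁ S ∣) (rank ∘ x∉p⇒x∈∁p ∘ proj₂) rank-injective)
  where
  open ≡-Reasoning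
  rank-injective : Injective _≡_ _≡_ (rank ∘ x∉p⇒x∈∁p ∘ proj₂)
  rank-injective {x , x∉S} {y , y∉S} same = vertex-≡ (begin
    x                                     ≡⟨ sym (members-rank (x∉p⇒x∈∁p x∉S)) ⟩
    members (∁ S) (rank (x∉p⇒x∈∁p x∉S))  ≡⟨ cong (members (∁ S)) same ⟩
    members (∁ S) (rank (x∉p⇒x∈∁p y∉S))  ≡⟨ members-rank (x∉p⇒x∈∁p y∉S) ⟩
    y                                     ∎)

ofSize : ∀ {m n} → m ≤ n → Subset n
ofSize z≤n       = ∅
ofSize (s≤s m≤n) = inside ∷ ofSize m≤n

∣ofSize∣ : ∀ {m n} (m≤n : m ≤ n) → ∣ ofSize m≤n ∣ ≡ m
∣ofSize∣ {n = n} z≤n = ∣⊥∣≡0 n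
∣ofSize∣ (s≤s m≤n)    = cong suc (∣ofSize∣ m≤n)

λv-K : ∀ n k .{{_ : NonZero k}} → λv≡ (K n) k (n ∸ (k + k % 2))
λv-K n k = (S , S-removes , ∣ofSize∣ (m∸n≤m n q)) , minimal
  where
  open ≤-Reasoning
  q : ℕ
  q = k + k % 2
  S : Subset n
  S = ofSize (m∸n≤m n q)

  S-removes : IsRemovalSet (K n) k S
  S-removes = Equivalence.from (removal⇔K∁ S) (Equivalence.from (K-colourable⇔ k) (begin
    ∣ ∁ S ∣        ≡⟨ ∣∁p∣≡n∸∣p∣ S ⟩
    n ∸ ∣ S ∣      ≡⟨ cong (n ∸_) (∣ofSize∣ (m∸n≤m n q)) ⟩
    n ∸ (n ∸ q)    ≤⟨ m≤n+o⇒m∸n≤o n (n ∸ q) n≤[n∸q]+q ⟩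
    q              ∎))
    where
    n≤[n∸q]+q : n ≤ n ∸ q + q
    n≤[n∸q]+q = ≤-trans (m≤n+m∸n n q) (≤-reflexive (+-comm q (n ∸ q)))

  minimal : ∀ T → IsRemovalSet (K n) k T → n ∸ q ≤ ∣ T ∣
  minimal T T-removes = m≤n+o⇒m∸n≤o n q (begin
    n                  ≡⟨ sym (m∸n+n≡m (∣p∣≤n T)) ⟩
    n ∸ ∣ T ∣ + ∣ T ∣  ≡⟨ cong (_+ ∣ T ∣) (sym (∣∁p∣≡n∸∣p∣ T)) ⟩
    ∣ ∁ T ∣ + ∣ T ∣    ≤⟨ +-monoˡ-≤ ∣ T ∣ ∁T-small ⟩
    q + ∣ T ∣          ∎)
    where
    ∁T-small : ∣ ∁ T ∣ ≤ q
    ∁T-small = Equivalence.to (K-colourable⇔ k) (Equivalence.to (removal⇔K∁ T) T-removes)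

mainTheorem15 : (n k : ℕ) → 1 ≤ k →
    (k ≥ n → λv≡ (K n) k 0) × (k < n → λv≡ (K n) k (n ∸ k ∸ (k % 2)))
mainTheorem15 n k 1≤k = small , large
  where
  instance
    k≢0 : NonZero k
    k≢0 = >-nonZero 1≤k

  small : k ≥ n → λv≡ (K n) k 0
  small n≤k = subst (λv≡ (K n) k) (m≤n⇒m∸n≡0 (m≤n⇒m≤n+o (k % 2) n≤k)) (λv-K n k)

  large : k < n → λv≡ (K n) k (n ∸ k ∸ (k % 2))
  large _ = subst (λv≡ (K n) k) (sym (∸-+-assoc n k (k % 2))) (λv-K n k)
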